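{- Let $k\ge1$ and let $p,q$ be positive integers with canonical $k$-representations $p=\sum_i\binom{c_{k-i}}{k-i}$ and $q=\sum_i\binom{a_{k-i}}{k-i}$, with $c_k\le a_k$. Let $m=p+q$ and suppose $m\ge\binom{a_k+1}{k}$, and let $m-\binom{a_k+1}{k}=\sum_i\binom{b_{k-i}}{k-i}$ be its canonical $k$-representation (empty if this number is $0$). Then $$\binom{a_k+1}{k+1}+\sum_i\binom{b_{k-i}}{k+1-i}>\sum_i\binom{c_{k-i}}{k+1-i}+\sum_i\binom{a_{k-i}}{k+1-i}.$$
   Context: $\binom{n}{l}=0$ if $l>n$ or $l<0$. The canonical $k$-representation of a positive integer $p$ is the unique expression $p=\sum_{i=0}^s\binom{a_{k-i}}{k-i}$ with $s\ge0$ and $a_k>a_{k-1}>\dots>a_{k-s}\ge k-s>0$; the number $0$ is represented by the empty sequence, for which all such sums are $0$. Sums over $i$ run over the indices present in the respective representation. -}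

module Defs where

open import Data.Nat using (ℕ; zero; suc; _+_; _∸_; _≤_; _<_)
open import Data.Nat.Combinatorics using (_C_)
open import Data.List using (List; []; _∷_)
open import Data.Product using (_×_)
open import Relation.Binary.PropositionalEquality using (_≡_)

KSum : ℕ → List ℕ → ℕ
KSum k []       = 0
KSum k (a ∷ as) = a C k + KSum (k ∸ 1) as

-- Canon k [a_k, ..., a_{k-s}] : the list is a canonical k-representation
-- sequence, i.e. a_k > a_{k-1} > ... > a_{k-s} ≥ k-s > 0 (empty list allowed,
-- representing 0).
data Canon : ℕ → List ℕ → Set where
  nil    : ∀ {k} → Canon k []
  single : ∀ {k a} → 1 ≤ k → k ≤ a → Canon k (a ∷ [])
  cons   : ∀ {k a b as} → b < a → Canon k (b ∷ as) → Canon (suc k) (a ∷ b ∷ as)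

IsCanonRep : ℕ → ℕ → List ℕ → Set
IsCanonRep k p as = Canon k as × KSum k as ≡ p

-- The paper's inequality is an exchange inequality for the "cascade" function
--   F_{k,B}(x) = Σ_i C(a_{k-i}, k+1-i)   where   x = Σ_i C(a_{k-i}, k-i)
-- is the canonical k-representation of x with all a_i < B, defined for 0 ≤ x ≤ C(B,k).
-- Writing N = C(a+1,k), the hypotheses give p, q < N, so with s = p + q - N the three
-- numbers s, e = p - s, r = q - s satisfy s + e + r = N and e, r ≥ 1, and the claim reads
--   F(s + e) + F(s + r) < F(s) + C(a+1, k+1)                          (strict exchange).
-- By Pascal's rule F_{k+1,B+1} is F_{k+1,B} on [0, C(B,k+1)] followed by F_{k,B} shifted
-- by C(B,k+1) and raised by C(B,k+2).
module Submission where

open import Defs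
open import Data.Nat
open import Data.Nat.Properties
open import Data.Nat.Combinatorics using (_C_; k>n⇒nCk≡0; nCk+nC[k+1]≡[n+1]C[k+1])
open import Data.Nat.Tactic.RingSolver using (solve-∀)
open import Algebra.Properties.CommutativeSemigroup +-commutativeSemigroup
  using (interchange; x∙yz≈y∙xz; x∙yz≈yx∙z; xy∙z≈xz∙y; xy∙z≈x∙zy)
open import Data.List using (List; []; _∷_)
open import Data.Sum using (_⊎_; inj₁; inj₂)
open import Data.Product using (Σ; _,_; _×_; proj₁; proj₂)
open import Data.Empty using (⊥; ⊥-elim)
open import Relation.Nullary using (yes; no)
open import Relation.Binary.PropositionalEquality

-- Binomial coefficients by Pascal's rule, so that the Pascal step holds definitionally.
bin : ℕ → ℕ → ℕ
bin n zero = 1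
bin zero (suc k) = 0
bin (suc n) (suc k) = bin n (suc k) + bin n k

bin≡C : ∀ n k → bin n k ≡ n C k
bin≡C n zero = refl
bin≡C zero (suc k) = sym (k>n⇒nCk≡0 {0} {suc k} (s≤s z≤n))
bin≡C (suc n) (suc k) = trans (cong₂ _+_ (bin≡C n (suc k)) (bin≡C n k))
  (trans (+-comm (n C suc k) (n C k)) (nCk+nC[k+1]≡[n+1]C[k+1] n k))

bin-1 : ∀ n → bin n 1 ≡ n
bin-1 zero = refl
bin-1 (suc n) = trans (cong (_+ 1) (bin-1 n)) (+-comm n 1)

bin-vanishes : ∀ n k → n < k → bin n k ≡ 0
bin-vanishes zero (suc k) _ = refl
bin-vanishes (suc n) (suc k) (s≤s n<k) =
  cong₂ _+_ (bin-vanishes n (suc k) (m<n⇒m<1+n n<k)) (bin-vanishes n k n<k)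

bin-positive : ∀ n k → k ≤ n → 1 ≤ bin n k
bin-positive n zero _ = s≤s z≤n
bin-positive (suc n) (suc k) (s≤s k≤n) = ≤-trans (bin-positive n k k≤n) (m≤n+m _ _)

bin-step : ∀ n k → bin n k ≤ bin (suc n) k
bin-step n zero = ≤-refl
bin-step n (suc k) = m≤m+n _ _

bin-mono : ∀ {n n'} k → n ≤ n' → bin n k ≤ bin n' k
bin-mono {n} {n'} k n≤n' with m≤n⇒∃[o]m+o≡n n≤n'
... | o , refl = go o
  where
  go : ∀ o → bin n k ≤ bin (n + o) k
  go zero = ≤-reflexive (cong (λ x → bin x k) (sym (+-identityʳ n)))
  go (suc o) = ≤-trans (go o) (subst (λ x → bin (n + o) k ≤ bin x k) (sym (+-suc n o)) (bin-step (n + o) k))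

bin-vanishes-next : ∀ n k → bin n k ≡ 0 → bin n (suc k) ≡ 0
bin-vanishes-next n k e with k ≤? n
... | yes k≤n = ⊥-elim (n≮0 (subst (1 ≤_) e (bin-positive n k k≤n)))
... | no k≰n = bin-vanishes n (suc k) (m<n⇒m<1+n (≰⇒> k≰n))

-- cascade m B e is the m-th cascade value of e ≤ C(B,m) over the ground set B.
cascade : ℕ → ℕ → ℕ → ℕ
cascade zero B zero = 0
cascade zero B (suc e) = B
cascade (suc m) zero e = 0
cascade (suc m) (suc B) e with e ≤? bin B (suc m)
... | yes _ = cascade (suc m) B e
... | no _ = bin B (suc (suc m)) + cascade m B (e ∸ bin B (suc m))

cascade-low : ∀ m B e → e ≤ bin B (suc m) → cascade (suc m) (suc B) e ≡ cascade (suc m) B e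
cascade-low m B e h with e ≤? bin B (suc m)
... | yes _ = refl
... | no h' = ⊥-elim (h' h)

cascade-zero : ∀ m B → cascade m B 0 ≡ 0
cascade-zero zero B = refl
cascade-zero (suc m) zero = refl
cascade-zero (suc m) (suc B) = trans (cascade-low m B 0 z≤n) (cascade-zero (suc m) B)

cascade-full : ∀ m B → cascade m B (bin B m) ≡ bin B (suc m)
cascade-high-zero : ∀ m B → cascade (suc m) (suc B) (bin B (suc m) + 0) ≡ bin B (suc (suc m)) + cascade m B 0

cascade-high : ∀ m B t → cascade (suc m) (suc B) (bin B (suc m) + t) ≡ bin B (suc (suc m)) + cascade m B t
cascade-high m B zero = cascade-high-zero m B
cascade-high m B (suc t) with bin B (suc m) + suc t ≤? bin B (suc m)
... | yes h = ⊥-elim (<⇒≱ (m<m+n (bin B (suc m)) {suc t} (s≤s z≤n)) h)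
... | no _ = cong (λ x → bin B (suc (suc m)) + cascade m B x) (m+n∸m≡n (bin B (suc m)) (suc t))

cascade-high-zero m B = begin
  cascade (suc m) (suc B) (bin B (suc m) + 0) ≡⟨ cascade-low m B _ (≤-reflexive (+-identityʳ _)) ⟩
  cascade (suc m) B (bin B (suc m) + 0)       ≡⟨ cong (cascade (suc m) B) (+-identityʳ _) ⟩
  cascade (suc m) B (bin B (suc m))           ≡⟨ cascade-full (suc m) B ⟩
  bin B (suc (suc m))                         ≡⟨ sym (+-identityʳ _) ⟩
  bin B (suc (suc m)) + 0                     ≡⟨ cong (bin B (suc (suc m)) +_) (sym (cascade-zero m B)) ⟩
  bin B (suc (suc m)) + cascade m B 0         ∎
  where open ≡-Reasoning

cascade-full zero B = sym (bin-1 B)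
cascade-full (suc m) zero = refl
cascade-full (suc m) (suc B) = trans (cascade-high m B (bin B m)) (cong (bin B (suc (suc m)) +_) (cascade-full m B))

split : ∀ e X → e ≤ X ⊎ Σ ℕ (λ t → e ≡ X + t)
split e X with e ≤? X
... | yes h = inj₁ h
... | no h = inj₂ (e ∸ X , sym (m+[n∸m]≡n (<⇒≤ (≰⇒> h))))

split-strict : ∀ e X → e < X ⊎ Σ ℕ (λ t → e ≡ X + t)
split-strict e X with e <? X
... | yes h = inj₁ h
... | no h = inj₂ (e ∸ X , sym (m+[n∸m]≡n (≮⇒≥ h)))

difference : ∀ {a b} → a ≤ b → Σ ℕ (λ u → b ≡ a + u)
difference h with m≤n⇒∃[o]m+o≡n h
... | u , p = u , sym p

positive-difference : ∀ {a b} → a < b → Σ ℕ (λ u → (b ≡ a + u) × (1 ≤ u))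
positive-difference {a} h with difference (<⇒≤ h)
... | zero , p = ⊥-elim (<-irrefl (trans (sym (+-identityʳ a)) (sym p)) h)
... | suc u , p = suc u , p , s≤s z≤n

split-positive : ∀ e X → e ≤ X ⊎ Σ ℕ (λ t → (e ≡ X + t) × (1 ≤ t))
split-positive e X with e ≤? X
... | yes h = inj₁ h
... | no h = inj₂ (positive-difference (≰⇒> h))

cascade-bound : ∀ m B e → cascade m B e ≤ bin B (suc m)
cascade-bound zero B zero = z≤n
cascade-bound zero B (suc e) = ≤-reflexive (sym (bin-1 B))
cascade-bound (suc m) zero e = z≤n
cascade-bound (suc m) (suc B) e with split e (bin B (suc m))
... | inj₁ h = ≤-trans (≤-reflexive (cascade-low m B e h)) (≤-trans (cascade-bound (suc m) B e) (m≤m+n _ _))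
... | inj₂ (t , refl) = ≤-trans (≤-reflexive (cascade-high m B t)) (+-monoʳ-≤ _ (cascade-bound m B t))

cascade-stable : ∀ m B B' e → B ≤ B' → e ≤ bin B (suc m) → cascade (suc m) B e ≡ cascade (suc m) B' e
cascade-stable m zero zero e _ _ = refl
cascade-stable m B (suc B') e h e≤ with m≤n⇒m<n∨m≡n h
... | inj₂ refl = refl
... | inj₁ (s≤s B≤B') = trans (cascade-stable m B B' e B≤B' e≤)
        (sym (cascade-low m B' e (≤-trans e≤ (bin-mono (suc m) B≤B'))))

Superadditive : ℕ → (ℕ → ℕ) → Set
Superadditive N f = ∀ s t → s + t ≤ N → f s + f t ≤ f (s + t)

-- Exchange inequality: two initial segments [0, s+e] and [0, s+r] covering [0, N]
-- (N = s + e + r) are worth at most their overlap [0, s] plus the whole interval.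
Exchange : ℕ → ℕ → (ℕ → ℕ) → Set
Exchange N V f = ∀ s e r → s + e + r ≡ N → f (s + e) + f (s + r) ≤ f s + V

StrictExchange : ℕ → ℕ → (ℕ → ℕ) → Set
StrictExchange N V f = ∀ s e r → s + e + r ≡ N → 1 ≤ e → 1 ≤ r → f (s + e) + f (s + r) < f s + V

Below : ℕ → (ℕ → ℕ) → ℕ → (ℕ → ℕ) → Set
Below N f M g = ∀ e → e ≤ N → e ≤ M → f e ≤ g e

-- Tail comparison: cutting the last e points off [0, N] loses at most as much of f
-- (full value V) as cutting them off [0, M] loses of g (full value W).
Tail : ℕ → ℕ → (ℕ → ℕ) → ℕ → ℕ → (ℕ → ℕ) → Set
Tail N V f M W g = ∀ e r₁ r₂ → r₁ + e ≡ N → r₂ + e ≡ M → V + g r₂ ≤ W + f r₁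

StrictTail : ℕ → ℕ → (ℕ → ℕ) → ℕ → ℕ → (ℕ → ℕ) → Set
StrictTail N V f M W g = ∀ e r₁ r₂ → 1 ≤ e → r₁ + e ≡ N → r₂ + e ≡ M → V + g r₂ < W + f r₁

exchange-weaken : ∀ {N V f} → (∀ x → f x ≤ V) → StrictExchange N V f → Exchange N V f
exchange-weaken {V = V} {f} bound strict s zero r _ =
  subst (λ z → f z + f (s + r) ≤ f s + V) (sym (+-identityʳ s)) (+-monoʳ-≤ (f s) (bound (s + r)))
exchange-weaken {V = V} {f} bound strict s (suc e) zero _ =
  subst (λ z → f (s + suc e) + f z ≤ f s + V) (sym (+-identityʳ s))
    (subst (_≤ f s + V) (+-comm (f s) (f (s + suc e))) (+-monoʳ-≤ (f s) (bound (s + suc e))))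
exchange-weaken bound strict s (suc e) (suc r) eq = <⇒≤ (strict s (suc e) (suc r) eq (s≤s z≤n) (s≤s z≤n))

tail-weaken : ∀ {N V f M W g} → f N ≡ V → g M ≡ W → StrictTail N V f M W g → Tail N V f M W g
tail-weaken {V = V} {f} {W = W} {g} fN gM strict zero r₁ r₂ refl refl = ≤-reflexive (begin
  V + g r₂        ≡⟨ cong (λ x → V + g x) (sym (+-identityʳ r₂)) ⟩
  V + g (r₂ + 0)  ≡⟨ cong (V +_) gM ⟩
  V + W           ≡⟨ +-comm V W ⟩
  W + V           ≡⟨ cong (W +_) (sym fN) ⟩
  W + f (r₁ + 0)  ≡⟨ cong (λ x → W + f x) (+-identityʳ r₁) ⟩
  W + f r₁        ∎)
  where open ≡-Reasoning
tail-weaken fN gM strict (suc e) r₁ r₂ e₁ e₂ = <⇒≤ (strict (suc e) r₁ r₂ (s≤s z≤n) e₁ e₂)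

tail-refl : ∀ {N V f} → Tail N V f N V f
tail-refl e r₁ r₂ e₁ e₂ with +-cancelʳ-≡ e r₁ r₂ (trans e₁ (sym e₂))
... | refl = ≤-refl

record Glued (X Xb : ℕ) (PX PY P' : ℕ → ℕ) : Set where
  constructor glued
  field
    low  : ∀ e → e ≤ X → P' e ≡ PX e
    high : ∀ t → P' (X + t) ≡ Xb + PY t

module SuperadditiveGluing {X Y Xb : ℕ} {PX PY P' : ℕ → ℕ} (gl : Glued X Xb PX PY P') where
  open Glued gl
  open ≤-Reasoning

  -- s, t ≤ X < s + t: with X = w + r + u, s = w + r and t = u + w this is the exchange
  -- inequality of PX followed by PX w ≤ PY w.
  low-low-crossing : Exchange X Xb PX → Below X PX Y PY →
    ∀ s t w → s ≤ X → t ≤ X → s + t ≡ X + w → s + t ≤ X + Y → P' s + P' t ≤ P' (s + t)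
  low-low-crossing exchX belowXY s t w s≤X t≤X eq st≤ with difference s≤X
  ... | u , refl with +-cancelˡ-≡ s t (u + w) (trans eq (+-assoc s u w))
  ...   | refl with difference (+-cancelˡ-≤ u w s (subst (u + w ≤_) (+-comm s u) t≤X))
  ...     | r , refl = begin
    P' (w + r) + P' (u + w)   ≡⟨ cong₂ _+_ (low (w + r) s≤X) (low (u + w) t≤X) ⟩
    PX (w + r) + PX (u + w)   ≡⟨ +-comm (PX (w + r)) (PX (u + w)) ⟩
    PX (u + w) + PX (w + r)   ≡⟨ cong (λ z → PX z + PX (w + r)) (+-comm u w) ⟩
    PX (w + u) + PX (w + r)   ≤⟨ exchX w u r (xy∙z≈xz∙y w u r) ⟩
    PX w + Xb                 ≤⟨ +-monoˡ-≤ Xb (belowXY w w≤X w≤Y) ⟩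
    PY w + Xb                 ≡⟨ +-comm (PY w) Xb ⟩
    Xb + PY w                 ≡⟨ sym (high w) ⟩
    P' (w + r + u + w)        ≡⟨ cong P' (sym eq) ⟩
    P' (w + r + (u + w))      ∎
    where
    w≤X : w ≤ w + r + u
    w≤X = ≤-trans (m≤m+n w r) (m≤m+n (w + r) u)
    w≤Y : w ≤ Y
    w≤Y = +-cancelˡ-≤ (w + r + u) w Y (subst (_≤ w + r + u + Y) eq st≤)

  -- s ≤ X ≤ t: first PX s ≤ PY s, then superadditivity of PY.
  low-high : Superadditive Y PY → Below X PX Y PY →
    ∀ s t' → s ≤ X → s + (X + t') ≤ X + Y → P' s + P' (X + t') ≤ P' (s + (X + t'))
  low-high supY belowXY s t' s≤X st≤ = begin
    P' s + P' (X + t')    ≡⟨ cong₂ _+_ (low s s≤X) (high t') ⟩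
    PX s + (Xb + PY t')   ≤⟨ +-monoˡ-≤ (Xb + PY t') (belowXY s s≤X s≤Y) ⟩
    PY s + (Xb + PY t')   ≡⟨ x∙yz≈y∙xz (PY s) Xb (PY t') ⟩
    Xb + (PY s + PY t')   ≤⟨ +-monoʳ-≤ Xb (supY s t' st'≤Y) ⟩
    Xb + PY (s + t')      ≡⟨ sym (high (s + t')) ⟩
    P' (X + (s + t'))     ≡⟨ cong P' (x∙yz≈y∙xz X s t') ⟩
    P' (s + (X + t'))     ∎
    where
    st'≤Y : s + t' ≤ Y
    st'≤Y = +-cancelˡ-≤ X (s + t') Y (subst (_≤ X + Y) (x∙yz≈y∙xz s X t') st≤)
    s≤Y : s ≤ Y
    s≤Y = ≤-trans (m≤m+n s t') st'≤Y

  -- X ≤ s, t: first Xb = PX X ≤ PY X, then superadditivity of PY twice.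
  high-high : PX X ≡ Xb → Superadditive Y PY → Below X PX Y PY →
    ∀ s' t' → X + s' + (X + t') ≤ X + Y → P' (X + s') + P' (X + t') ≤ P' (X + s' + (X + t'))
  high-high PXfull supY belowXY s' t' st≤ = begin
    P' (X + s') + P' (X + t')     ≡⟨ cong₂ _+_ (high s') (high t') ⟩
    (Xb + PY s') + (Xb + PY t')   ≡⟨ +-assoc Xb (PY s') (Xb + PY t') ⟩
    Xb + (PY s' + (Xb + PY t'))   ≡⟨ cong (Xb +_) (sym (+-assoc (PY s') Xb (PY t'))) ⟩
    Xb + (PY s' + Xb + PY t')     ≤⟨ +-monoʳ-≤ Xb (+-monoˡ-≤ (PY t') (+-monoʳ-≤ (PY s') Xb≤PYX)) ⟩
    Xb + (PY s' + PY X + PY t')   ≤⟨ +-monoʳ-≤ Xb (+-monoˡ-≤ (PY t') (supY s' X s'X≤Y)) ⟩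
    Xb + (PY (s' + X) + PY t')    ≤⟨ +-monoʳ-≤ Xb (supY (s' + X) t' s'Xt'≤Y) ⟩
    Xb + PY (s' + X + t')         ≡⟨ sym (high (s' + X + t')) ⟩
    P' (X + (s' + X + t'))        ≡⟨ cong P' (shift X s' t') ⟩
    P' (X + s' + (X + t'))        ∎
    where
    shift : ∀ X s' t' → X + (s' + X + t') ≡ X + s' + (X + t')
    shift = solve-∀
    s'Xt'≤Y : s' + X + t' ≤ Y
    s'Xt'≤Y = +-cancelˡ-≤ X (s' + X + t') Y (subst (_≤ X + Y) (sym (shift X s' t')) st≤)
    s'X≤Y : s' + X ≤ Y
    s'X≤Y = ≤-trans (m≤m+n (s' + X) t') s'Xt'≤Y
    Xb≤PYX : Xb ≤ PY X
    Xb≤PYX = subst (_≤ PY X) PXfull (belowXY X ≤-refl (≤-trans (m≤n+m X s') s'X≤Y))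

  superadditive-glue : PX X ≡ Xb → Superadditive X PX → Superadditive Y PY → Exchange X Xb PX →
    Below X PX Y PY → Superadditive (X + Y) P'
  superadditive-glue PXfull supX supY exchX belowXY s t st≤ with split s X | split t X
  ... | inj₁ s≤X | inj₂ (t' , refl) = low-high supY belowXY s t' s≤X st≤
  ... | inj₂ (s' , refl) | inj₁ t≤X =
    subst₂ _≤_ (+-comm (P' t) (P' (X + s'))) (cong P' (+-comm t (X + s')))
      (low-high supY belowXY t s' t≤X (subst (_≤ X + Y) (+-comm (X + s') t) st≤))
  ... | inj₂ (s' , refl) | inj₂ (t' , refl) = high-high PXfull supY belowXY s' t' st≤
  ... | inj₁ s≤X | inj₁ t≤X with split (s + t) X
  ...   | inj₁ st≤X = subst₂ _≤_ (sym (cong₂ _+_ (low s s≤X) (low t t≤X))) (sym (low (s + t) st≤X)) (supX s t st≤X)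
  ...   | inj₂ (w , eq) = low-low-crossing exchX belowXY s t w s≤X t≤X eq st≤

open SuperadditiveGluing using (superadditive-glue)

module ExchangeGluing {X Y Xb Yb : ℕ} {PX PY P' : ℕ → ℕ} (gl : Glued X Xb PX PY P') where
  open Glued gl
  open ≤-Reasoning

  regroup : ∀ s u v r → s + u + (v + r) ≡ s + (u + v) + r
  regroup = solve-∀

  -- X ≤ s: everything happens in the second piece, where PY satisfies strict exchange.
  exchange-in-second : StrictExchange Y Yb PY →
    ∀ s' e r → X + s' + e + r ≡ X + Y → 1 ≤ e → 1 ≤ r →
    P' (X + s' + e) + P' (X + s' + r) < P' (X + s') + (Xb + Yb)
  exchange-in-second exchY s' e r eq 1≤e 1≤r = begin-strict
    P' (X + s' + e) + P' (X + s' + r)        ≡⟨ cong₂ _+_ (high′ e) (high′ r) ⟩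
    (Xb + PY (s' + e)) + (Xb + PY (s' + r))  ≡⟨ interchange Xb (PY (s' + e)) Xb (PY (s' + r)) ⟩
    (Xb + Xb) + (PY (s' + e) + PY (s' + r))  <⟨ +-monoʳ-< (Xb + Xb) (exchY s' e r s'er≡Y 1≤e 1≤r) ⟩
    (Xb + Xb) + (PY s' + Yb)                 ≡⟨ interchange Xb Xb (PY s') Yb ⟩
    (Xb + PY s') + (Xb + Yb)                 ≡⟨ cong (_+ (Xb + Yb)) (sym (high s')) ⟩
    P' (X + s') + (Xb + Yb)                  ∎
    where
    high′ : ∀ x → P' (X + s' + x) ≡ Xb + PY (s' + x)
    high′ x = trans (cong P' (+-assoc X s' x)) (high (s' + x))
    shift : ∀ X s' e r → X + (s' + e + r) ≡ X + s' + e + r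
    shift = solve-∀
    s'er≡Y : s' + e + r ≡ Y
    s'er≡Y = +-cancelˡ-≡ X _ _ (trans (shift X s' e r) eq)

  -- s < X = s + u < s + e, and u ≥ r (u = r + w): exchange for PX on X = s + r + w and
  -- the tail comparison of PX and PY for the last r points, after cancelling PX (s + w).
  straddle-short : Exchange X Xb PX → StrictTail X Xb PX Y Yb PY →
    ∀ s r w v → X ≡ s + (r + w) → Y ≡ v + r → 1 ≤ r →
    P' (s + (r + w + v)) + P' (s + r) < P' s + (Xb + Yb)
  straddle-short exchX tailXY s r w v refl refl 1≤r = begin-strict
    P' (s + (r + w + v)) + P' (s + r)  ≡⟨ cong₂ _+_ (trans (cong P' (sym (+-assoc s (r + w) v))) (high v))
                                                   (low (s + r) (+-monoʳ-≤ s (m≤m+n r w))) ⟩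
    (Xb + PY v) + PX (s + r)           <⟨ +-cancelʳ-< (PX (s + w)) _ _ combined ⟩
    PX s + (Xb + Yb)                   ≡⟨ cong (_+ (Xb + Yb)) (sym (low s (m≤m+n s (r + w)))) ⟩
    P' s + (Xb + Yb)                   ∎
    where
    rearrange : ∀ y z a x → (y + z) + (a + x) ≡ (a + (x + y)) + z
    rearrange = solve-∀
    combined : (Xb + PY v) + PX (s + r) + PX (s + w) < PX s + (Xb + Yb) + PX (s + w)
    combined = begin-strict
      (Xb + PY v) + PX (s + r) + PX (s + w)      ≡⟨ +-assoc (Xb + PY v) (PX (s + r)) (PX (s + w)) ⟩
      (Xb + PY v) + (PX (s + r) + PX (s + w))    ≤⟨ +-monoʳ-≤ (Xb + PY v) (exchX s r w (+-assoc s r w)) ⟩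
      (Xb + PY v) + (PX s + Xb)                  <⟨ +-monoˡ-< (PX s + Xb)
                                                      (tailXY r (s + w) v 1≤r (xy∙z≈x∙zy s w r) refl) ⟩
      (Yb + PX (s + w)) + (PX s + Xb)            ≡⟨ rearrange Yb (PX (s + w)) (PX s) Xb ⟩
      PX s + (Xb + Yb) + PX (s + w)              ∎

  -- s < X = s + u < s + e, and u ≤ r (r = u + r₂): the tail comparison for the last u
  -- points together with superadditivity of PY.
  straddle-long : Superadditive Y PY → StrictTail X Xb PX Y Yb PY →
    ∀ s u v r₂ → X ≡ s + u → Y ≡ v + (u + r₂) → 1 ≤ u →
    P' (s + (u + v)) + P' (s + (u + r₂)) < P' s + (Xb + Yb)
  straddle-long supY tailXY s u v r₂ refl refl 1≤u = begin-strict
    P' (s + (u + v)) + P' (s + (u + r₂))  ≡⟨ cong₂ _+_ (trans (cong P' (sym (+-assoc s u v))) (high v))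
                                                      (trans (cong P' (sym (+-assoc s u r₂))) (high r₂)) ⟩
    (Xb + PY v) + (Xb + PY r₂)            ≡⟨ +-assoc Xb (PY v) (Xb + PY r₂) ⟩
    Xb + (PY v + (Xb + PY r₂))            ≡⟨ cong (Xb +_) (x∙yz≈y∙xz (PY v) Xb (PY r₂)) ⟩
    Xb + (Xb + (PY v + PY r₂))            ≤⟨ +-monoʳ-≤ Xb (+-monoʳ-≤ Xb (supY v r₂ (+-monoʳ-≤ v (m≤n+m r₂ u)))) ⟩
    Xb + (Xb + PY (v + r₂))               <⟨ +-monoʳ-< Xb tail-u ⟩
    Xb + (Yb + PX s)                      ≡⟨ sym (+-assoc Xb Yb (PX s)) ⟩
    (Xb + Yb) + PX s                      ≡⟨ +-comm (Xb + Yb) (PX s) ⟩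
    PX s + (Xb + Yb)                      ≡⟨ cong (_+ (Xb + Yb)) (sym (low s (m≤m+n s u))) ⟩
    P' s + (Xb + Yb)                      ∎
    where
    cut : ∀ v u r₂ → v + r₂ + u ≡ v + (u + r₂)
    cut = solve-∀
    tail-u : Xb + PY (v + r₂) < Yb + PX s
    tail-u = tailXY u s (v + r₂) 1≤u refl (cut v u r₂)

  exchange-straddle : Superadditive Y PY → Exchange X Xb PX → StrictTail X Xb PX Y Yb PY →
    ∀ s e r v → s + e + r ≡ X + Y → 1 ≤ r → s < X → s + e ≡ X + v → P' (s + e) + P' (s + r) < P' s + (Xb + Yb)
  exchange-straddle supY exchX tailXY s e r v eq 1≤r s<X s+e≡X+v with positive-difference s<X
  ... | u , X≡s+u , 1≤u with +-cancelˡ-≡ s e (u + v) (trans s+e≡X+v (trans (cong (_+ v) X≡s+u) (+-assoc s u v)))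
  ...   | refl with split u r
  ...     | inj₂ (w , refl) = straddle-short exchX tailXY s r w v X≡s+u Y≡v+r 1≤r
    where
    Y≡v+r : Y ≡ v + r
    Y≡v+r = sym (+-cancelˡ-≡ X (v + r) Y (trans (cong (_+ (v + r)) X≡s+u)
              (trans (regroup s (r + w) v r) eq)))
  ...     | inj₁ u≤r with difference u≤r
  ...       | r₂ , refl = straddle-long supY tailXY s u v r₂ X≡s+u Y≡v+r 1≤u
    where
    Y≡v+r : Y ≡ v + (u + r₂)
    Y≡v+r = sym (+-cancelˡ-≡ X (v + (u + r₂)) Y (trans (cong (_+ (v + (u + r₂))) X≡s+u)
              (trans (regroup s u v (u + r₂)) eq)))

  -- s + e ≤ X and e > Y (e = Y + e'): two exchange inequalities of PX and the tail
  -- comparison for the last Y points; the cancelled terms are PX (s + e') and PX (s + e' + r₀).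
  exchange-in-first-long : PY 0 ≡ 0 → (Y ≡ 0 → X ≡ 0) → Exchange X Xb PX → StrictTail X Xb PX Y Yb PY →
    ∀ s e' r₀ → X ≡ s + (Y + e') + r₀ → 1 ≤ Y + e' →
    P' (s + (Y + e')) + P' (s + (r₀ + Y)) < P' s + (Xb + Yb)
  exchange-in-first-long PY0 Y0⇒X0 exchX tailXY s e' r₀ refl 1≤e = begin-strict
    P' (s + (Y + e')) + P' (s + (r₀ + Y))  ≡⟨ cong₂ _+_ (low _ (m≤m+n _ r₀)) (low _ second≤X) ⟩
    Fa + Fb                                <⟨ +-cancelʳ-< (Fc + Fd) (Fa + Fb) _ combined ⟩
    PX s + (Xb + Yb)                       ≡⟨ cong (_+ (Xb + Yb)) (sym (low s s≤X)) ⟩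
    P' s + (Xb + Yb)                       ∎
    where
    Fa Fb Fc Fd : ℕ
    Fa = PX (s + (Y + e'))
    Fb = PX (s + (r₀ + Y))
    Fc = PX (s + e')
    Fd = PX (s + e' + r₀)
    s≤X : s ≤ s + (Y + e') + r₀
    s≤X = ≤-trans (m≤m+n s (Y + e')) (m≤m+n _ r₀)
    second≤X : s + (r₀ + Y) ≤ s + (Y + e') + r₀
    second≤X = subst (s + (r₀ + Y) ≤_) (shift₄ s e' Y r₀) (m≤m+n _ e')
      where
      shift₄ : ∀ s e' Y r₀ → s + (r₀ + Y) + e' ≡ s + (Y + e') + r₀
      shift₄ = solve-∀
    regroup₁ : ∀ s e' Y r₀ → s + e' + (r₀ + Y) ≡ s + (Y + e') + r₀
    regroup₁ = solve-∀
    regroup₂ : ∀ s e' Y r₀ → s + e' + Y + r₀ ≡ s + (Y + e') + r₀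
    regroup₂ = solve-∀
    regroup₃ : ∀ s e' Y r₀ → s + e' + r₀ + Y ≡ s + (Y + e') + r₀
    regroup₃ = solve-∀
    1≤Y : 1 ≤ Y
    1≤Y with Y ≟ 0
    ... | no Y≢0 = n≢0⇒n>0 Y≢0
    ... | yes Y≡0 = ⊥-elim (<-irrefl (sym (Y0⇒X0 Y≡0)) (≤-trans 1≤e (≤-trans (m≤n+m (Y + e') s) (m≤m+n _ r₀))))
    exch₁ : Fc + Fb ≤ PX s + Xb
    exch₁ = exchX s e' (r₀ + Y) (regroup₁ s e' Y r₀)
    exch₂ : Fa + Fd ≤ Fc + Xb
    exch₂ = subst (λ z → PX z + Fd ≤ Fc + Xb) (trans (+-assoc s e' Y) (cong (s +_) (+-comm e' Y)))
              (exchX (s + e') Y r₀ (regroup₂ s e' Y r₀))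
    tail-Y : Xb < Yb + Fd
    tail-Y = subst (_< Yb + Fd) (+-identityʳ Xb)
               (subst (λ z → Xb + z < Yb + Fd) PY0 (tailXY Y (s + e' + r₀) 0 1≤Y (regroup₃ s e' Y r₀) refl))
    rearrange₁ : ∀ a b c d → (a + b) + (c + d) ≡ (a + d) + (c + b)
    rearrange₁ = solve-∀
    rearrange₂ : ∀ c x p y d → (c + x) + (p + (y + d)) ≡ (p + (x + y)) + (c + d)
    rearrange₂ = solve-∀
    combined : (Fa + Fb) + (Fc + Fd) < (PX s + (Xb + Yb)) + (Fc + Fd)
    combined = begin-strict
      (Fa + Fb) + (Fc + Fd)              ≡⟨ rearrange₁ Fa Fb Fc Fd ⟩
      (Fa + Fd) + (Fc + Fb)              ≤⟨ +-mono-≤ exch₂ exch₁ ⟩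
      (Fc + Xb) + (PX s + Xb)         <⟨ +-monoʳ-< (Fc + Xb) (+-monoʳ-< (PX s) tail-Y) ⟩
      (Fc + Xb) + (PX s + (Yb + Fd))   ≡⟨ rearrange₂ Fc Xb (PX s) Yb Fd ⟩
      (PX s + (Xb + Yb)) + (Fc + Fd)   ∎

  -- s + e ≤ X and e ≤ Y (Y = e + r₂): exchange of PX and the tail comparison for the last
  -- e points, after cancelling PX (s + r₀).
  exchange-in-first-short : Exchange X Xb PX → StrictTail X Xb PX Y Yb PY →
    ∀ s e r₀ r₂ → X ≡ s + e + r₀ → Y ≡ e + r₂ → 1 ≤ e →
    P' (s + e) + P' (s + (r₀ + Y)) < P' s + (Xb + Yb)
  exchange-in-first-short exchX tailXY s e r₀ r₂ refl refl 1≤e = begin-strict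
    P' (s + e) + P' (s + (r₀ + (e + r₂)))  ≡⟨ cong₂ _+_ (low (s + e) (m≤m+n _ r₀))
                                                       (trans (cong P' (shift s e r₀ r₂)) (high r₂)) ⟩
    PX (s + e) + (Xb + PY r₂)              <⟨ +-cancelʳ-< (PX (s + r₀)) _ _ combined ⟩
    PX s + (Xb + Yb)                       ≡⟨ cong (_+ (Xb + Yb)) (sym (low s (≤-trans (m≤m+n s e) (m≤m+n _ r₀)))) ⟩
    P' s + (Xb + Yb)                       ∎
    where
    shift : ∀ s e r₀ r₂ → s + (r₀ + (e + r₂)) ≡ s + e + r₀ + r₂
    shift = solve-∀
    rearrange : ∀ a x y z → (a + x) + (y + z) ≡ (a + (x + y)) + z
    rearrange = solve-∀
    combined : PX (s + e) + (Xb + PY r₂) + PX (s + r₀) < PX s + (Xb + Yb) + PX (s + r₀)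
    combined = begin-strict
      PX (s + e) + (Xb + PY r₂) + PX (s + r₀)    ≡⟨ xy∙z≈xz∙y (PX (s + e)) (Xb + PY r₂) (PX (s + r₀)) ⟩
      PX (s + e) + PX (s + r₀) + (Xb + PY r₂)    ≤⟨ +-monoˡ-≤ (Xb + PY r₂) (exchX s e r₀ refl) ⟩
      (PX s + Xb) + (Xb + PY r₂)                 <⟨ +-monoʳ-< (PX s + Xb)
                                                      (tailXY e (s + r₀) r₂ 1≤e (xy∙z≈xz∙y s r₀ e) (+-comm r₂ e)) ⟩
      (PX s + Xb) + (Yb + PX (s + r₀))           ≡⟨ rearrange (PX s) Xb Yb (PX (s + r₀)) ⟩
      PX s + (Xb + Yb) + PX (s + r₀)             ∎

  exchange-glue : PY 0 ≡ 0 → (Y ≡ 0 → X ≡ 0) → Superadditive Y PY → Exchange X Xb PX →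
    StrictExchange Y Yb PY → StrictTail X Xb PX Y Yb PY → StrictExchange (X + Y) (Xb + Yb) P'
  exchange-glue PY0 Y0⇒X0 supY exchX exchY tailXY s e r eq 1≤e 1≤r with split-strict s X
  ... | inj₂ (s' , refl) = exchange-in-second exchY s' e r eq 1≤e 1≤r
  ... | inj₁ s<X with split (s + e) X
  ...   | inj₂ (v , s+e≡X+v) = exchange-straddle supY exchX tailXY s e r v eq 1≤r s<X s+e≡X+v
  ...   | inj₁ se≤X with difference se≤X
  ...     | r₀ , X≡ser₀ with +-cancelˡ-≡ (s + e) r (r₀ + Y) (trans eq (trans (cong (_+ Y) X≡ser₀) (+-assoc (s + e) r₀ Y)))
  ...       | refl with split e Y
  ...         | inj₂ (e' , refl) = exchange-in-first-long PY0 Y0⇒X0 exchX tailXY s e' r₀ X≡ser₀ 1≤e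
  ...         | inj₁ e≤Y = exchange-in-first-short exchX tailXY s e r₀ (proj₁ (difference e≤Y)) X≡ser₀ (proj₂ (difference e≤Y)) 1≤e

open ExchangeGluing using (exchange-glue)

module TailGluing {Xb Yb Ub Vb : ℕ} {PX PY PU PV Pj Pi : ℕ → ℕ} where
  open ≤-Reasoning

  regroup-end : ∀ X e r → X + (e + r) ≡ X + r + e
  regroup-end = solve-∀

  regroup-middle : ∀ r V t → r + (V + t) ≡ r + t + V
  regroup-middle = solve-∀

  -- The cut stays inside both second pieces: the tail comparison of PY and PV.
  tail-glue-both-inside : ∀ {X Y U V : ℕ} → Glued X Xb PX PY Pj → Glued U Ub PU PV Pi →
    StrictTail Y Yb PY V Vb PV →
    ∀ e r₁ r₂ → 1 ≤ e → r₁ + e ≡ X + Y → r₂ + e ≡ U + V → e ≤ Y → e ≤ V →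
    (Xb + Yb) + Pi r₂ < (Ub + Vb) + Pj r₁
  tail-glue-both-inside {X} {Y} {U} {V} (glued _ highJ) (glued _ highI) tailYV e r₁ r₂ 1≤e eq₁ eq₂ e≤Y e≤V
    with difference e≤Y | difference e≤V
  ... | ry , refl | rv , refl
    with +-cancelʳ-≡ e r₁ (X + ry) (trans eq₁ (regroup-end X e ry))
       | +-cancelʳ-≡ e r₂ (U + rv) (trans eq₂ (regroup-end U e rv))
  ... | refl | refl = begin-strict
    (Xb + Yb) + Pi (U + rv)   ≡⟨ cong ((Xb + Yb) +_) (highI rv) ⟩
    (Xb + Yb) + (Ub + PV rv)  ≡⟨ interchange Xb Yb Ub (PV rv) ⟩
    (Xb + Ub) + (Yb + PV rv)  <⟨ +-monoʳ-< (Xb + Ub) (tailYV e ry rv 1≤e (+-comm ry e) (+-comm rv e)) ⟩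
    (Xb + Ub) + (Vb + PY ry)  ≡⟨ cong (_+ (Vb + PY ry)) (+-comm Xb Ub) ⟩
    (Ub + Xb) + (Vb + PY ry)  ≡⟨ interchange Ub Xb Vb (PY ry) ⟩
    (Ub + Vb) + (Xb + PY ry)  ≡⟨ cong ((Ub + Vb) +_) (sym (highJ ry)) ⟩
    (Ub + Vb) + Pj (X + ry)   ∎

  -- The cut stays inside PY but reaches into PU: the non-strict tail comparison of PY
  -- and PU, and PY (ry + V) < Vb + PY ry, which comes from exchange of PY and the tail
  -- comparison of PY and PV for the last V points.
  tail-glue-j-inside : ∀ {X Y U V : ℕ} → Glued X Xb PX PY Pj → Glued U Ub PU PV Pi →
    PV 0 ≡ 0 → (V ≡ 0 → U ≡ 0) → StrictTail Y Yb PY V Vb PV → Exchange Y Yb PY → Tail Y Yb PY U Ub PU →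
    ∀ e r₁ r₂ → r₁ + e ≡ X + Y → r₂ + e ≡ U + V → e ≤ Y → ∀ t → e ≡ V + t → 1 ≤ t →
    (Xb + Yb) + Pi r₂ < (Ub + Vb) + Pj r₁
  tail-glue-j-inside {X} {Y} {U} {V} (glued _ highJ) (glued lowI _) PV0 V0⇒U0 tailYV exchY tailYU≤
    e r₁ r₂ eq₁ eq₂ e≤Y t refl 1≤t with difference e≤Y
  ... | ry , refl
    with +-cancelʳ-≡ (V + t) r₁ (X + ry) (trans eq₁ (regroup-end X (V + t) ry))
       | +-cancelʳ-≡ V (r₂ + t) U (trans (sym (regroup-middle r₂ V t)) eq₂)
  ... | refl | refl = begin-strict
    (Xb + Yb) + Pi r₂          ≡⟨ cong ((Xb + Yb) +_) (lowI r₂ (m≤m+n r₂ t)) ⟩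
    (Xb + Yb) + PU r₂          ≡⟨ +-assoc Xb Yb (PU r₂) ⟩
    Xb + (Yb + PU r₂)          ≤⟨ +-monoʳ-≤ Xb (tailYU≤ t (ry + V) r₂ (shift ry V t) refl) ⟩
    Xb + (Ub + PY (ry + V))    <⟨ +-monoʳ-< Xb (+-monoʳ-< Ub drop-V) ⟩
    Xb + (Ub + (Vb + PY ry))   ≡⟨ rearrange Xb Ub Vb (PY ry) ⟩
    (Ub + Vb) + (Xb + PY ry)   ≡⟨ cong ((Ub + Vb) +_) (sym (highJ ry)) ⟩
    (Ub + Vb) + Pj (X + ry)    ∎
    where
    shift : ∀ ry V t → ry + V + t ≡ V + t + ry
    shift = solve-∀
    shift′ : ∀ ry V t → ry + t + V ≡ V + t + ry
    shift′ = solve-∀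
    rearrange : ∀ x u v y → x + (u + (v + y)) ≡ (u + v) + (x + y)
    rearrange = solve-∀
    1≤V : 1 ≤ V
    1≤V with V ≟ 0
    ... | no V≢0 = n≢0⇒n>0 V≢0
    ... | yes V≡0 = ⊥-elim (<-irrefl (sym (V0⇒U0 V≡0)) (≤-trans 1≤t (m≤n+m t r₂)))
    tail-V : Yb < Vb + PY (ry + t)
    tail-V = subst (_< Vb + PY (ry + t)) (+-identityʳ Yb)
      (subst (λ z → Yb + z < Vb + PY (ry + t)) PV0 (tailYV V (ry + t) 0 1≤V (shift′ ry V t) refl))
    drop-V : PY (ry + V) < Vb + PY ry
    drop-V = +-cancelʳ-< (PY (ry + t)) _ _ (begin-strict
      PY (ry + V) + PY (ry + t)   ≤⟨ exchY ry V t (shift ry V t) ⟩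
      PY ry + Yb                  <⟨ +-monoʳ-< (PY ry) tail-V ⟩
      PY ry + (Vb + PY (ry + t))  ≡⟨ x∙yz≈yx∙z (PY ry) Vb (PY (ry + t)) ⟩
      Vb + PY ry + PY (ry + t)    ∎)

  -- The cut stays inside PV but reaches into PX: Yb = PY Y ≤ PV Y, superadditivity of PV
  -- and the tail comparison of PX and PV.
  tail-glue-i-inside : ∀ {X Y U V : ℕ} → Glued X Xb PX PY Pj → Glued U Ub PU PV Pi →
    PY Y ≡ Yb → Below Y PY V PV → Superadditive V PV → StrictTail X Xb PX V Vb PV →
    ∀ e r₁ r₂ → r₁ + e ≡ X + Y → r₂ + e ≡ U + V → ∀ t → e ≡ Y + t → 1 ≤ t → e ≤ V →
    (Xb + Yb) + Pi r₂ < (Ub + Vb) + Pj r₁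
  tail-glue-i-inside {X} {Y} {U} {V} (glued lowJ _) (glued _ highI) PYfull belowYV supV tailXV
    e r₁ r₂ eq₁ eq₂ t refl 1≤t e≤V with difference e≤V
  ... | rv , refl
    with +-cancelʳ-≡ Y (r₁ + t) X (trans (sym (regroup-middle r₁ Y t)) eq₁)
       | +-cancelʳ-≡ (Y + t) r₂ (U + rv) (trans eq₂ (regroup-end U (Y + t) rv))
  ... | refl | refl = begin-strict
    (Xb + Yb) + Pi (U + rv)      ≡⟨ cong ((Xb + Yb) +_) (highI rv) ⟩
    (Xb + Yb) + (Ub + PV rv)     ≡⟨ rearrange Xb Yb Ub (PV rv) ⟩
    Ub + (Xb + (Yb + PV rv))     ≤⟨ +-monoʳ-≤ Ub (+-monoʳ-≤ Xb (+-monoˡ-≤ (PV rv) Yb≤PVY)) ⟩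
    Ub + (Xb + (PV Y + PV rv))   ≡⟨ cong (λ z → Ub + (Xb + z)) (+-comm (PV Y) (PV rv)) ⟩
    Ub + (Xb + (PV rv + PV Y))   ≤⟨ +-monoʳ-≤ Ub (+-monoʳ-≤ Xb (supV rv Y rvY≤V)) ⟩
    Ub + (Xb + PV (rv + Y))      <⟨ +-monoʳ-< Ub (tailXV t r₁ (rv + Y) 1≤t refl (shift rv Y t)) ⟩
    Ub + (Vb + PX r₁)            ≡⟨ sym (+-assoc Ub Vb (PX r₁)) ⟩
    (Ub + Vb) + PX r₁            ≡⟨ cong ((Ub + Vb) +_) (sym (lowJ r₁ (m≤m+n r₁ t))) ⟩
    (Ub + Vb) + Pj r₁            ∎
    where
    shift : ∀ rv Y t → rv + Y + t ≡ Y + t + rv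
    shift = solve-∀
    rearrange : ∀ x y u p → (x + y) + (u + p) ≡ u + (x + (y + p))
    rearrange = solve-∀
    rvY≤V : rv + Y ≤ Y + t + rv
    rvY≤V = subst (rv + Y ≤_) (shift rv Y t) (m≤m+n (rv + Y) t)
    Yb≤PVY : Yb ≤ PV Y
    Yb≤PVY = subst (_≤ PV Y) PYfull (belowYV Y ≤-refl (≤-trans (m≤m+n Y t) (m≤m+n (Y + t) rv)))

  -- The cut reaches into both first pieces and Y ≤ V (V = Y + g): the tail comparisons of
  -- PX with PU and PV, exchange of PX, and Yb ≤ PV Y; the term Xb cancels.
  tail-glue-both-outside-≤ : ∀ {X Y U V : ℕ} → Glued X Xb PX PY Pj → Glued U Ub PU PV Pi →
    PY Y ≡ Yb → StrictTail X Xb PX U Ub PU → Exchange X Xb PX → Below Y PY V PV → Tail X Xb PX V Vb PV →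
    ∀ e r₁ r₂ → r₁ + e ≡ X + Y → r₂ + e ≡ U + V →
    ∀ t → e ≡ Y + t → ∀ t' → e ≡ V + t' → 1 ≤ t' → Y ≤ V →
    (Xb + Yb) + Pi r₂ < (Ub + Vb) + Pj r₁
  tail-glue-both-outside-≤ {X} {Y} {U} {V} (glued lowJ _) (glued lowI _) PYfull tailXU exchX belowYV tailXV≤
    e r₁ r₂ eq₁ eq₂ t refl t' eqt' 1≤t' Y≤V with difference Y≤V
  ... | g , refl with +-cancelˡ-≡ Y t (g + t') (trans eqt' (+-assoc Y g t'))
  ... | refl
    with +-cancelʳ-≡ Y (r₁ + (g + t')) X (trans (sym (regroup-middle r₁ Y (g + t'))) eq₁)
       | +-cancelʳ-≡ (Y + g) (r₂ + t') U
           (trans (sym (regroup-middle r₂ (Y + g) t')) (trans (cong (r₂ +_) (sym eqt')) eq₂))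
  ... | refl | refl = begin-strict
    (Xb + Yb) + Pi r₂    ≡⟨ cong ((Xb + Yb) +_) (lowI r₂ (m≤m+n r₂ t')) ⟩
    (Xb + Yb) + PU r₂    <⟨ +-cancelʳ-< Xb _ _ combined ⟩
    (Ub + Vb) + PX r₁    ≡⟨ cong ((Ub + Vb) +_) (sym (lowJ r₁ (m≤m+n r₁ (g + t')))) ⟩
    (Ub + Vb) + Pj r₁    ∎
    where
    shift₁ : ∀ r₁ g t' → r₁ + g + t' ≡ r₁ + (g + t')
    shift₁ = solve-∀
    shift₂ : ∀ r₁ g t' → r₁ + t' + g ≡ r₁ + (g + t')
    shift₂ = solve-∀
    rearrange : ∀ x y p → (x + y) + p + x ≡ (x + p) + (x + y)
    rearrange = solve-∀
    Yb≤PVY : Yb ≤ PV Y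
    Yb≤PVY = subst (_≤ PV Y) PYfull (belowYV Y ≤-refl (m≤m+n Y g))
    XbYb≤ : Xb + Yb ≤ Vb + PX (r₁ + t')
    XbYb≤ = ≤-trans (+-monoʳ-≤ Xb Yb≤PVY) (tailXV≤ g (r₁ + t') Y (shift₂ r₁ g t') refl)
    combined : (Xb + Yb) + PU r₂ + Xb < (Ub + Vb) + PX r₁ + Xb
    combined = begin-strict
      (Xb + Yb) + PU r₂ + Xb                     ≡⟨ rearrange Xb Yb (PU r₂) ⟩
      (Xb + PU r₂) + (Xb + Yb)                   <⟨ +-monoˡ-< (Xb + Yb) (tailXU t' (r₁ + g) r₂ 1≤t' (shift₁ r₁ g t') refl) ⟩
      (Ub + PX (r₁ + g)) + (Xb + Yb)             ≤⟨ +-monoʳ-≤ (Ub + PX (r₁ + g)) XbYb≤ ⟩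
      (Ub + PX (r₁ + g)) + (Vb + PX (r₁ + t'))   ≡⟨ interchange Ub (PX (r₁ + g)) Vb (PX (r₁ + t')) ⟩
      (Ub + Vb) + (PX (r₁ + g) + PX (r₁ + t'))   ≤⟨ +-monoʳ-≤ (Ub + Vb) (exchX r₁ g t' (+-assoc r₁ g t')) ⟩
      (Ub + Vb) + (PX r₁ + Xb)                   ≡⟨ sym (+-assoc (Ub + Vb) (PX r₁) Xb) ⟩
      (Ub + Vb) + PX r₁ + Xb                     ∎

  -- The cut reaches into both first pieces and V ≤ Y (Y = V + g): Yb ≤ Vb + PY g (tail
  -- comparison of PY and PV), PY g ≤ PU g, superadditivity of PU and the tail comparison
  -- of PX and PU.
  tail-glue-both-outside-≥ : ∀ {X Y U V : ℕ} → Glued X Xb PX PY Pj → Glued U Ub PU PV Pi →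
    PV 0 ≡ 0 → Tail Y Yb PY V Vb PV → StrictTail X Xb PX U Ub PU → Below Y PY U PU → Superadditive U PU →
    ∀ e r₁ r₂ → r₁ + e ≡ X + Y → r₂ + e ≡ U + V →
    ∀ t → e ≡ Y + t → 1 ≤ t → ∀ t' → e ≡ V + t' → ∀ g → Y ≡ V + g →
    (Xb + Yb) + Pi r₂ < (Ub + Vb) + Pj r₁
  tail-glue-both-outside-≥ {X} {Y} {U} {V} (glued lowJ _) (glued lowI _) PV0 tailYV≤ tailXU belowYU supU
    e r₁ r₂ eq₁ eq₂ t refl 1≤t t' eqt' g refl with +-cancelˡ-≡ V t' (g + t) (trans (sym eqt') (+-assoc V g t))
  ... | refl
    with +-cancelʳ-≡ (V + g) (r₁ + t) X (trans (sym (regroup-middle r₁ (V + g) t)) eq₁)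
       | +-cancelʳ-≡ V (r₂ + (g + t)) U
           (trans (sym (regroup-middle r₂ V (g + t))) (trans (cong (r₂ +_) (sym eqt')) eq₂))
  ... | refl | refl = begin-strict
    (Xb + Yb) + Pi r₂              ≡⟨ cong ((Xb + Yb) +_) (lowI r₂ (m≤m+n r₂ (g + t))) ⟩
    (Xb + Yb) + PU r₂              ≤⟨ +-monoˡ-≤ (PU r₂) (+-monoʳ-≤ Xb Yb≤VbPUg) ⟩
    (Xb + (Vb + PU g)) + PU r₂     ≡⟨ rearrange Xb Vb (PU g) (PU r₂) ⟩
    Vb + (Xb + (PU r₂ + PU g))     ≤⟨ +-monoʳ-≤ Vb (+-monoʳ-≤ Xb (supU r₂ g (+-monoʳ-≤ r₂ (m≤m+n g t)))) ⟩
    Vb + (Xb + PU (r₂ + g))        <⟨ +-monoʳ-< Vb (tailXU t r₁ (r₂ + g) 1≤t refl (+-assoc r₂ g t)) ⟩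
    Vb + (Ub + PX r₁)              ≡⟨ x∙yz≈yx∙z Vb Ub (PX r₁) ⟩
    (Ub + Vb) + PX r₁              ≡⟨ cong ((Ub + Vb) +_) (sym (lowJ r₁ (m≤m+n r₁ t))) ⟩
    (Ub + Vb) + Pj r₁              ∎
    where
    rearrange : ∀ x v p q → (x + (v + p)) + q ≡ v + (x + (q + p))
    rearrange = solve-∀
    tail-V : Yb ≤ Vb + PY g
    tail-V = subst (_≤ Vb + PY g) (+-identityʳ Yb)
      (subst (λ z → Yb + z ≤ Vb + PY g) PV0 (tailYV≤ V g 0 (+-comm g V) refl))
    Yb≤VbPUg : Yb ≤ Vb + PU g
    Yb≤VbPUg = ≤-trans tail-V
      (+-monoʳ-≤ Vb (belowYU g (m≤n+m g V) (≤-trans (m≤m+n g t) (m≤n+m (g + t) r₂))))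

  tail-glue : ∀ {X Y U V : ℕ} → Glued X Xb PX PY Pj → Glued U Ub PU PV Pi →
    PV 0 ≡ 0 → PY Y ≡ Yb → (V ≡ 0 → U ≡ 0) →
    StrictTail Y Yb PY V Vb PV → Tail Y Yb PY V Vb PV →
    StrictTail X Xb PX U Ub PU → StrictTail X Xb PX V Vb PV → Tail X Xb PX V Vb PV → Tail Y Yb PY U Ub PU →
    Exchange X Xb PX → Exchange Y Yb PY → Superadditive U PU → Superadditive V PV →
    Below Y PY V PV → Below Y PY U PU →
    StrictTail (X + Y) (Xb + Yb) Pj (U + V) (Ub + Vb) Pi
  tail-glue {Y = Y} {V = V} gj gi PV0 PYfull V0⇒U0 tailYV tailYV≤ tailXU tailXV tailXV≤ tailYU≤
    exchX exchY supU supV belowYV belowYU e r₁ r₂ 1≤e eq₁ eq₂ with split-positive e Y | split-positive e V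
  ... | inj₁ e≤Y | inj₁ e≤V =
    tail-glue-both-inside gj gi tailYV e r₁ r₂ 1≤e eq₁ eq₂ e≤Y e≤V
  ... | inj₁ e≤Y | inj₂ (t , eqt , 1≤t) =
    tail-glue-j-inside gj gi PV0 V0⇒U0 tailYV exchY tailYU≤ e r₁ r₂ eq₁ eq₂ e≤Y t eqt 1≤t
  ... | inj₂ (t , eqt , 1≤t) | inj₁ e≤V =
    tail-glue-i-inside gj gi PYfull belowYV supV tailXV e r₁ r₂ eq₁ eq₂ t eqt 1≤t e≤V
  ... | inj₂ (t , eqt , 1≤t) | inj₂ (t' , eqt' , 1≤t') with split Y V
  ...   | inj₁ Y≤V =
    tail-glue-both-outside-≤ gj gi PYfull tailXU exchX belowYV tailXV≤ e r₁ r₂ eq₁ eq₂ t eqt t' eqt' 1≤t' Y≤V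
  ...   | inj₂ (g , eqg) =
    tail-glue-both-outside-≥ gj gi PV0 tailYV≤ tailXU belowYU supU e r₁ r₂ eq₁ eq₂ t eqt 1≤t t' eqt' g eqg

open TailGluing using (tail-glue)

cascade-glued : ∀ m B → Glued (bin B (suc m)) (bin B (suc (suc m))) (cascade (suc m) B) (cascade m B) (cascade (suc m) (suc B))
cascade-glued m B = glued (cascade-low m B) (cascade-high m B)

cascade-empty : ∀ m e → cascade m 0 e ≡ 0
cascade-empty zero zero = refl
cascade-empty zero (suc e) = refl
cascade-empty (suc m) e = refl

-- At a positive level the single point 1 = C(j+1, j+1) has cascade value C(j+1, j+2) = 0.
cascade-one : ∀ j B → cascade (suc j) B 1 ≡ 0
cascade-one j zero = refl
cascade-one j (suc B) with bin B (suc j) ≟ 0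
... | no X≢0 = trans (cascade-low j B 1 (n≢0⇒n>0 X≢0)) (cascade-one j B)
... | yes X0 = begin
  cascade (suc j) (suc B) 1                          ≡⟨ cong (λ z → cascade (suc j) (suc B) (z + 1)) (sym X0) ⟩
  cascade (suc j) (suc B) (bin B (suc j) + 1)        ≡⟨ cascade-high j B 1 ⟩
  bin B (suc (suc j)) + cascade j B 1                ≡⟨ cong₂ _+_ (bin-vanishes-next B (suc j) X0) (lower j X0) ⟩
  0                                                  ∎
  where
  open ≡-Reasoning
  lower : ∀ j → bin B (suc j) ≡ 0 → cascade j B 1 ≡ 0
  lower zero x = trans (sym (bin-1 B)) x
  lower (suc j') _ = cascade-one j' B

-- Dropping the last point at a positive level loses less than B, the loss at level 0.
-- On the ground set B+1 the last point lies in the second Pascal piece, so this reduces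
-- to the same statement one level lower (or to level 0) on the ground set B.
cascade-drop-last : ∀ j B r → r + 1 ≡ bin B (suc j) → bin B (suc (suc j)) < B + cascade (suc j) B r
cascade-drop-last j zero r eq = ⊥-elim (1+n≢0 (trans (+-comm 1 r) eq))
cascade-drop-last j (suc B) r eq with difference 1≤C
  where
  1≤C : 1 ≤ bin B j
  1≤C with bin B j ≟ 0
  ... | no C≢0 = n≢0⇒n>0 C≢0
  ... | yes C≡0 = ⊥-elim (1+n≢0 (trans (+-comm 1 r) (trans eq (cong₂ _+_ (bin-vanishes-next B j C≡0) C≡0))))
... | y , C≡1+y with +-cancelʳ-≡ 1 r (bin B (suc j) + y) (trans eq (trans (cong (bin B (suc j) +_) C≡1+y) (shift (bin B (suc j)) y)))
  where
  shift : ∀ x y → x + (1 + y) ≡ x + y + 1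
  shift = solve-∀
... | refl = begin-strict
  bin B (suc (suc j)) + bin B (suc j)                   ≡⟨ +-comm (bin B (suc (suc j))) (bin B (suc j)) ⟩
  bin B (suc j) + bin B (suc (suc j))                   <⟨ +-monoˡ-< (bin B (suc (suc j))) (drop-lower j y y+1≡C) ⟩
  (suc B + cascade j B y) + bin B (suc (suc j))         ≡⟨ xy∙z≈x∙zy (suc B) (cascade j B y) (bin B (suc (suc j))) ⟩
  suc B + (bin B (suc (suc j)) + cascade j B y)         ≡⟨ cong (suc B +_) (sym (cascade-high j B y)) ⟩
  suc B + cascade (suc j) (suc B) (bin B (suc j) + y)   ∎
  where
  open ≤-Reasoning
  y+1≡C : y + 1 ≡ bin B j
  y+1≡C = trans (+-comm y 1) (sym C≡1+y)
  drop-lower : ∀ j y → y + 1 ≡ bin B j → bin B (suc j) < suc B + cascade j B y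
  drop-lower zero y e with +-cancelʳ-≡ 1 y 0 e
  ... | refl = subst (_< suc B + 0) (sym (bin-1 B)) (≤-trans (n<1+n B) (m≤m+n (suc B) 0))
  drop-lower (suc j') y e = <-trans (cascade-drop-last j' B y e) (+-monoˡ-< (cascade (suc j') B y) (n<1+n B))

cascade-below-level : ∀ i' j → suc i' < j → ∀ B B' → B ≤ B' → Superadditive (bin B' (suc i')) (cascade (suc i') B') →
  Below (bin B j) (cascade j B) (bin B' (suc i')) (cascade (suc i') B')
cascade-below-level i' (suc j') lt zero B' _ sup e _ _ = z≤n
cascade-below-level i' (suc j') lt (suc B) B' B≤ sup e e≤ e≤' with split e (bin B (suc j'))
... | inj₁ h = ≤-trans (≤-reflexive (cascade-low j' B e h))
                (cascade-below-level i' (suc j') lt B B' (≤-trans (n≤1+n B) B≤) sup e h e≤')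
... | inj₂ (t , refl) = begin
  cascade (suc j') (suc B) (X + t)                ≡⟨ cascade-high j' B t ⟩
  bin B (suc (suc j')) + cascade j' B t           ≤⟨ +-mono-≤ full≤ rest≤ ⟩
  cascade (suc i') B' X + cascade (suc i') B' t   ≤⟨ sup X t e≤' ⟩
  cascade (suc i') B' (X + t)                     ∎
  where
  open ≤-Reasoning
  X : ℕ
  X = bin B (suc j')
  B≤B' : B ≤ B'
  B≤B' = ≤-trans (n≤1+n B) B≤
  t≤Y : t ≤ bin B j'
  t≤Y = +-cancelˡ-≤ X _ _ e≤
  t≤N' : t ≤ bin B' (suc i')
  t≤N' = ≤-trans (m≤n+m t X) e≤'
  full≤ : bin B (suc (suc j')) ≤ cascade (suc i') B' X
  full≤ = subst (_≤ cascade (suc i') B' X) (cascade-full (suc j') B)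
            (cascade-below-level i' (suc j') lt B B' B≤B' sup X ≤-refl (≤-trans (m≤m+n X t) e≤'))
  rest≤ : cascade j' B t ≤ cascade (suc i') B' t
  rest≤ with m≤n⇒m<n∨m≡n (≤-pred lt)
  ... | inj₁ lt' = cascade-below-level i' j' lt' B B' B≤B' sup t t≤Y t≤N'
  ... | inj₂ refl = ≤-reflexive (cascade-stable i' B B' t B≤B' t≤Y)

cascade-below : ∀ j i → i ≤ j → ∀ B → Superadditive (bin B i) (cascade i B) →
  Below (bin B j) (cascade j B) (bin B i) (cascade i B)
cascade-below j i i≤j B sup with m≤n⇒m<n∨m≡n i≤j
cascade-below j i i≤j B sup | inj₂ refl = λ _ _ _ → ≤-refl
cascade-below (suc j') zero _ B sup | inj₁ _ = level-zero
  where
  level-zero : Below (bin B (suc j')) (cascade (suc j') B) 1 (cascade zero B)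
  level-zero zero _ _ = ≤-reflexive (trans (cascade-zero (suc j') B) (sym (cascade-zero zero B)))
  level-zero (suc zero) _ _ = ≤-trans (≤-reflexive (cascade-one j' B)) z≤n
  level-zero (suc (suc e)) _ (s≤s ())
cascade-below j (suc i') _ B sup | inj₁ lt = cascade-below-level i' j lt B B ≤-refl sup

-- Level 0 lives on [0, 1]: value 0 at 0 and B at 1.
superadditive-level-zero : ∀ B → Superadditive 1 (cascade 0 B)
superadditive-level-zero B zero t _ = ≤-refl
superadditive-level-zero B (suc s) zero _ =
  ≤-reflexive (trans (+-identityʳ _) (cong (cascade 0 B) (sym (+-identityʳ (suc s)))))
superadditive-level-zero B (suc s) (suc t) (s≤s h) = ⊥-elim (n≮0 (subst (_≤ 0) (+-suc s t) h))

-- The tail comparison against level 0: only the last point can be cut off [0, 1].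
tail-level-zero : ∀ j B → StrictTail (bin B (suc j)) (bin B (suc (suc j))) (cascade (suc j) B) 1 (bin B 1) (cascade 0 B)
tail-level-zero j B zero r1 r2 () _ _
tail-level-zero j B (suc zero) r1 zero _ eq1 refl =
  subst₂ _<_ (sym (+-identityʳ _)) (cong (_+ cascade (suc j) B r1) (sym (bin-1 B))) (cascade-drop-last j B r1 eq1)
tail-level-zero j B (suc zero) r1 (suc r2) _ _ eq2 = ⊥-elim (1+n≢0 (m+n≡0⇒n≡0 r2 (cong pred eq2)))
tail-level-zero j B (suc (suc e)) r1 r2 _ _ eq2 =
  ⊥-elim (1+n≢0 (m+n≡0⇒n≡0 r2 (cong pred (trans (sym (+-suc r2 (suc e))) eq2))))

no-two-parts : ∀ s e r → 1 ≤ e → 1 ≤ r → s + e + r ≤ 1 → ⊥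
no-two-parts s e r e1 r1 h = n≮n 1 (≤-trans (+-mono-≤ e1 r1)
  (≤-trans (subst (e + r ≤_) (sym (+-assoc s e r)) (m≤n+m (e + r) s)) h))

bin-empty≤1 : ∀ m → bin 0 m ≤ 1
bin-empty≤1 zero = ≤-refl
bin-empty≤1 (suc m) = z≤n

-- The three properties of the cascade functions over the ground set B, proved together
-- by induction on B.
record Stage (B : ℕ) : Set where
  field
    superadditive : ∀ m → Superadditive (bin B m) (cascade m B)
    exchange      : ∀ m → StrictExchange (bin B m) (bin B (suc m)) (cascade m B)
    tail          : ∀ j i → i < j →
                    StrictTail (bin B j) (bin B (suc j)) (cascade j B) (bin B i) (bin B (suc i)) (cascade i B)

-- Base case: over the empty ground set all cascade functions vanish and all intervals
-- are too short for the strict inequalities to have instances.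
stage-empty : Stage 0
stage-empty = record
  { superadditive = λ m s t _ → ≤-reflexive
      (trans (cong₂ _+_ (cascade-empty m s) (cascade-empty m t)) (sym (cascade-empty m (s + t))))
  ; exchange = λ m s e r eq e1 r1 → ⊥-elim (no-two-parts s e r e1 r1 (subst (_≤ 1) (sym eq) (bin-empty≤1 m)))
  ; tail = λ { (suc j) i _ e r1 r2 e1 eq1 _ → ⊥-elim (<-irrefl (sym (m+n≡0⇒n≡0 r1 eq1)) e1) }
  }

stage-step : ∀ B → Stage B → Stage (suc B)
stage-step B S = record { superadditive = superadditive' ; exchange = exchange' ; tail = tail' }
  where
  open Stage S
  exchange≤ : ∀ m → Exchange (bin B m) (bin B (suc m)) (cascade m B)
  exchange≤ m = exchange-weaken (cascade-bound m B) (exchange m)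
  tail≤ : ∀ j i → i ≤ j → Tail (bin B j) (bin B (suc j)) (cascade j B) (bin B i) (bin B (suc i)) (cascade i B)
  tail≤ j i i≤j with m≤n⇒m<n∨m≡n i≤j
  ... | inj₁ i<j = tail-weaken (cascade-full j B) (cascade-full i B) (tail j i i<j)
  ... | inj₂ refl = tail-refl {bin B j} {bin B (suc j)} {cascade j B}
  below : ∀ j i → i ≤ j → Below (bin B j) (cascade j B) (bin B i) (cascade i B)
  below j i i≤j = cascade-below j i i≤j B (superadditive i)

  superadditive' : ∀ m → Superadditive (bin (suc B) m) (cascade m (suc B))
  superadditive' zero = superadditive-level-zero (suc B)
  superadditive' (suc m) = superadditive-glue (cascade-glued m B) (cascade-full (suc m) B)
    (superadditive (suc m)) (superadditive m) (exchange≤ (suc m)) (below (suc m) m (n≤1+n m))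

  exchange' : ∀ m → StrictExchange (bin (suc B) m) (bin (suc B) (suc m)) (cascade m (suc B))
  exchange' zero s e r eq e1 r1 = ⊥-elim (no-two-parts s e r e1 r1 (≤-reflexive eq))
  exchange' (suc m) = exchange-glue (cascade-glued m B) (cascade-zero m B) (bin-vanishes-next B m)
    (superadditive m) (exchange≤ (suc m)) (exchange m) (tail (suc m) m (n<1+n m))

  tail' : ∀ j i → i < j → StrictTail (bin (suc B) j) (bin (suc B) (suc j)) (cascade j (suc B))
                                     (bin (suc B) i) (bin (suc B) (suc i)) (cascade i (suc B))
  tail' (suc j) zero _ = tail-level-zero j (suc B)
  tail' (suc j) (suc i) i+1<j+1 = tail-glue (cascade-glued j B) (cascade-glued i B)
    (cascade-zero i B) (cascade-full j B) (bin-vanishes-next B i)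
    (tail j i i<j) (tail≤ j i (<⇒≤ i<j))
    (tail (suc j) (suc i) i+1<j+1) (tail (suc j) i (m<n⇒m<1+n i<j)) (tail≤ (suc j) i (m≤n⇒m≤1+n (<⇒≤ i<j))) (tail≤ j (suc i) i<j)
    (exchange≤ (suc j)) (exchange≤ j) (superadditive (suc i)) (superadditive i)
    (below j i (<⇒≤ i<j)) (below j (suc i) i<j)
    where
    i<j : i < j
    i<j = ≤-pred i+1<j+1

stage : ∀ B → Stage B
stage zero = stage-empty
stage (suc B) = stage-step B (stage B)

excess-complement : ∀ {R N p q e} → R + N ≡ p + q → N ≡ q + e → R + e ≡ p
excess-complement {R} {N} {p} {q} {e} R+N≡p+q N≡q+e = +-cancelʳ-≡ q (R + e) p (begin
  R + e + q    ≡⟨ +-assoc R e q ⟩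
  R + (e + q)  ≡⟨ cong (R +_) (+-comm e q) ⟩
  R + (q + e)  ≡⟨ cong (R +_) (sym N≡q+e) ⟩
  R + N        ≡⟨ R+N≡p+q ⟩
  p + q        ∎)
  where open ≡-Reasoning

excess-bound : ∀ {p q N} → p < N → q < N → N ≤ p + q → p + q ∸ N < N
excess-bound {p} {q} {N} p<N q<N N≤p+q =
  +-cancelʳ-< N (p + q ∸ N) N (subst (_< N + N) (sym (m∸n+n≡m N≤p+q)) (+-mono-< p<N q<N))

-- With R = p + q - C(B,k) this is the
-- strict exchange inequality for the splitting C(B,k) = R + (p - R) + (q - R).
cascade-pair-exchange : ∀ k B p q → p < bin B k → q < bin B k → bin B k ≤ p + q →
  cascade k B p + cascade k B q < bin B (suc k) + cascade k B (p + q ∸ bin B k)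
cascade-pair-exchange k B p q p<N q<N N≤p+q
  with positive-difference q<N | positive-difference p<N
... | e , N≡q+e , 1≤e | r , N≡p+r , 1≤r =
  subst₂ _<_ (cong₂ _+_ (cong F R+e≡p) (cong F R+r≡q)) (+-comm (F R) (bin B (suc k))) strict
  where
  F : ℕ → ℕ
  F = cascade k B
  R : ℕ
  R = p + q ∸ bin B k
  R+N≡p+q : R + bin B k ≡ p + q
  R+N≡p+q = m∸n+n≡m N≤p+q
  R+e≡p : R + e ≡ p
  R+e≡p = excess-complement R+N≡p+q N≡q+e
  R+r≡q : R + r ≡ q
  R+r≡q = excess-complement (trans R+N≡p+q (+-comm p q)) N≡p+r
  strict : F (R + e) + F (R + r) < F R + bin B (suc k)
  strict = Stage.exchange (stage B) k R e r (trans (cong (_+ r) R+e≡p) (sym N≡p+r)) 1≤e 1≤r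

ksum-cons : ∀ k a as → KSum k (a ∷ as) ≡ bin a k + KSum (k ∸ 1) as
ksum-cons k a as = cong (_+ KSum (k ∸ 1) as) (sym (bin≡C a k))

canonical-sum-bound : ∀ {k a as} → Canon k (a ∷ as) → KSum k (a ∷ as) < bin (suc a) k
canonical-sum-bound {suc k} {a} {[]} (single _ k<a) =
  subst (_< bin a (suc k) + bin a k) (sym (trans (ksum-cons (suc k) a []) (+-identityʳ _)))
    (m<m+n (bin a (suc k)) (bin-positive a k (≤-trans (n≤1+n k) k<a)))
canonical-sum-bound {suc k} {a} {b ∷ bs} (cons b<a c) =
  subst (_< bin a (suc k) + bin a k) (sym (ksum-cons (suc k) a (b ∷ bs)))
    (+-monoʳ-< (bin a (suc k)) (≤-trans (canonical-sum-bound c) (bin-mono k b<a)))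

cascade-canonical-sum : ∀ {k a as B} → Canon k (a ∷ as) → a < B → KSum (suc k) (a ∷ as) ≡ cascade k B (KSum k (a ∷ as))
cascade-canonical-sum {zero} (single () _)
cascade-canonical-sum {suc k} {a} {as} {B} c a<B = begin
  KSum (suc (suc k)) (a ∷ as)                          ≡⟨ ksum-cons (suc (suc k)) a as ⟩
  bin a (suc (suc k)) + KSum (suc k) as                ≡⟨ cong (bin a (suc (suc k)) +_) (rest c) ⟩
  bin a (suc (suc k)) + cascade k a (KSum k as)        ≡⟨ sym (cascade-high k a _) ⟩
  cascade (suc k) (suc a) (bin a (suc k) + KSum k as)  ≡⟨ cong (cascade (suc k) (suc a)) (sym (ksum-cons (suc k) a as)) ⟩
  cascade (suc k) (suc a) (KSum (suc k) (a ∷ as))      ≡⟨ cascade-stable k (suc a) B _ a<B (<⇒≤ (canonical-sum-bound c)) ⟩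
  cascade (suc k) B (KSum (suc k) (a ∷ as))            ∎
  where
  open ≡-Reasoning
  rest : Canon (suc k) (a ∷ as) → KSum (suc k) as ≡ cascade k a (KSum k as)
  rest (single _ _) = sym (cascade-zero k a)
  rest (cons b<a c') = cascade-canonical-sum c' b<a

canonical-bound : ∀ {k p a as B} → IsCanonRep k p (a ∷ as) → a < B → p < bin B k
canonical-bound {k} (c , refl) a<B = ≤-trans (canonical-sum-bound c) (bin-mono k a<B)

cascade-canonical : ∀ {k p a as B} → IsCanonRep k p (a ∷ as) → a < B → KSum (suc k) (a ∷ as) ≡ cascade k B p
cascade-canonical (c , refl) a<B = cascade-canonical-sum c a<B

cascade-canonical-list : ∀ {k r bs B} → IsCanonRep k r bs → r < bin B k → KSum (suc k) bs ≡ cascade k B r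
cascade-canonical-list {k} {B = B} (nil , refl) _ = sym (cascade-zero k B)
cascade-canonical-list {k} {bs = b ∷ bs} {B} rep@(_ , refl) r<N with b <? B
... | yes b<B = cascade-canonical rep b<B
... | no b≮B = ⊥-elim (<⇒≱ r<N (≤-trans (bin-mono k (≮⇒≥ b≮B))
                 (subst (bin b k ≤_) (sym (ksum-cons k b bs)) (m≤m+n (bin b k) _))))

lemma3p4 : (k p q c a : ℕ) (cs as bs : List ℕ) →
    1 ≤ k → 1 ≤ p → 1 ≤ q →
    IsCanonRep k p (c ∷ cs) → IsCanonRep k q (a ∷ as) → c ≤ a →
    suc a C k ≤ p + q →
    IsCanonRep k ((p + q) ∸ (suc a C k)) bs →
    KSum (suc k) (c ∷ cs) + KSum (suc k) (a ∷ as) < suc a C suc k + KSum (suc k) bs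
lemma3p4 k p q c a cs as bs _ _ _ rep-p rep-q c≤a N≤p+q rep-r = begin-strict
  KSum (suc k) (c ∷ cs) + KSum (suc k) (a ∷ as)
    ≡⟨ cong₂ _+_ (cascade-canonical rep-p (s≤s c≤a)) (cascade-canonical rep-q ≤-refl) ⟩
  F p + F q
    <⟨ cascade-pair-exchange k (suc a) p q p<N q<N N≤p+q' ⟩
  bin (suc a) (suc k) + F (p + q ∸ bin (suc a) k)
    ≡⟨ cong₂ _+_ (bin≡C (suc a) (suc k)) (sym (cascade-canonical-list rep-r' (excess-bound p<N q<N N≤p+q'))) ⟩
  suc a C suc k + KSum (suc k) bs ∎
  where
  open ≤-Reasoning
  F : ℕ → ℕ
  F = cascade k (suc a)
  p<N : p < bin (suc a) k
  p<N = canonical-bound rep-p (s≤s c≤a)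
  q<N : q < bin (suc a) k
  q<N = canonical-bound rep-q ≤-refl
  N≤p+q' : bin (suc a) k ≤ p + q
  N≤p+q' = subst (_≤ p + q) (sym (bin≡C (suc a) k)) N≤p+q
  rep-r' : IsCanonRep k (p + q ∸ bin (suc a) k) bs
  rep-r' = subst (λ N → IsCanonRep k (p + q ∸ N) bs) (sym (bin≡C (suc a) k)) rep-r
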